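{- Let $E\neq\emptyset$ be an equivalence relation and let $\mathrm{Pt}_E=\{p\subseteq E : E|p|E=E,\ p|E|p\subseteq \mathrm{Id}_E\}$. Then: (i) $p\in\mathrm{Pt}_E$ iff for every equivalence class $U$ of $E$ there is $u\in U$ with $p\cap U^2=\{\langle u,u\rangle\}$; (ii) if $p\in\mathrm{Pt}_E$ then $p=p^{ -1}\subseteq\mathrm{Id}_E$; (iii) for all $R,S\subseteq E$ and $p,q\in\mathrm{Pt}_E$: (a) $E|p|R|q|E\cap E|p|S|q|E=E|p|(R\cap S)|q|E$; (b) $E|R|p|E\cap E|p|S|E=E|R|p|S|E$; (c) $E|p|R|q|E=E|q|R^{ -1}|p|E$; (iv) for every $R\subseteq E$ there exist $p,q\in\mathrm{Pt}_E$ with $E|R|E=E|p|R|q|E$; (v) for all $R,S\subseteq E$ there exists $p\in\mathrm{Pt}_E$ with $E|R|S|E=E|R|p|S|E$.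
   Context: For binary relations, $R|S=\{\langle x,z\rangle:\exists y\,(\langle x,y\rangle\in R\wedge\langle y,z\rangle\in S)\}$, $R^{ -1}=\{\langle x,y\rangle:\langle y,x\rangle\in R\}$. $\mathrm{Id}_E=\{\langle x,x\rangle:\langle x,x\rangle\in E\}$. The elements of $\mathrm{Pt}_E$ are called the points of $E$. -}

module Defs where

open import Data.Product using (Σ; ∃; ∃-syntax; _×_; _,_)
open import Data.Sum using (_⊎_)
open import Relation.Nullary using (¬_)
open import Relation.Binary.PropositionalEquality using (_≡_)

Rel₂ : Set → Set₁
Rel₂ A = A → A → Set

module _ {A : Set} where

  infixr 9 _∣_
  infixr 8 _∩_
  infix 4 _⊆_ _≐_

  _∣_ : Rel₂ A → Rel₂ A → Rel₂ A
  (R ∣ S) x z = ∃[ y ] (R x y × S y z)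

  inv : Rel₂ A → Rel₂ A
  inv R x y = R y x

  _∩_ : Rel₂ A → Rel₂ A → Rel₂ A
  (R ∩ S) x y = R x y × S x y

  Id : Rel₂ A → Rel₂ A
  Id E x y = (x ≡ y) × E x x

  _⊆_ : Rel₂ A → Rel₂ A → Set
  R ⊆ S = ∀ x y → R x y → S x y

  _≐_ : Rel₂ A → Rel₂ A → Set
  R ≐ S = (R ⊆ S) × (S ⊆ R)

  -- E is an equivalence relation (a set of pairs that is symmetric and
  -- transitive; it is then reflexive on its field)
  IsEquivRel : Rel₂ A → Set
  IsEquivRel E = (∀ x y → E x y → E y x) × (∀ x y z → E x y → E y z → E x z)

  NonEmpty : Rel₂ A → Set
  NonEmpty E = ∃[ x ] ∃[ y ] E x y

  IsClass : Rel₂ A → (A → Set) → Set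
  IsClass E U = ∃[ a ] (E a a × (∀ x → (U x → E a x) × (E a x → U x)))

  Pt : Rel₂ A → Rel₂ A → Set
  Pt E p = (p ⊆ E) × ((E ∣ p ∣ E) ≐ E) × ((p ∣ E ∣ p) ⊆ Id E)

-- Classical metatheory (the paper works in classical set theory with choice):
-- excluded middle, and an extensional Hilbert choice operator on A.
LEM : Set₁
LEM = (P : Set) → P ⊎ ¬ P

ExtChoice : Set → Set₁
ExtChoice A = Σ ((A → Set) → A) λ ε →
    (∀ (P : A → Set) → ∃[ x ] P x → P (ε P))
  × (∀ (P Q : A → Set) → (∀ x → (P x → Q x) × (Q x → P x)) → ε P ≡ ε Q)

module Submission where

open import Defs
open import Data.Product using (Σ; ∃; ∃-syntax; _×_; _,_)
open import Relation.Binary.PropositionalEquality using (_≡_)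

open import Data.Empty using (⊥-elim)
open import Data.Product using (proj₁; proj₂)
open import Data.Sum using (inj₁; inj₂)
open import Relation.Binary.PropositionalEquality using (refl; sym; trans; subst; subst₂)

-- A point p ∈ Pt_E meets every
-- class of E in exactly one loop ⟨u,u⟩: the covering condition E|p|E = E gives
-- at least one p-pair in each class, and p|E|p ⊆ Id_E forces any two p-pairs
-- in one class to be the same loop ("point-unique").  Parts (i)-(iii) are
-- direct consequences of these two facts.
--
-- For the existence parts (iv) and (v) we build points from choice.  A class
-- selector is a function f with f x E x that is constant on classes; its fixed
-- points {⟨x,x⟩ : f x = x} form a point.  Using LEM and the extensional choice
-- operator, for any property Good of elements there is a selector choosing a
-- Good element in every class that contains one.  Then (v) selects an element
-- that is both an R-target and an S-source, and (iv) first selects an R-source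
-- and then, for it, an R-target.

module Points {A : Set} (E : Rel₂ A) (isE : IsEquivRel E) where

  E-sym : ∀ {x y} → E x y → E y x
  E-sym {x} {y} = proj₁ isE x y

  E-trans : ∀ {x y z} → E x y → E y z → E x z
  E-trans {x} {y} {z} = proj₂ isE x y z

  E-reflˡ : ∀ {x y} → E x y → E x x
  E-reflˡ e = E-trans e (E-sym e)

  E-reflʳ : ∀ {x y} → E x y → E y y
  E-reflʳ e = E-trans (E-sym e) e

  classOf : ∀ {x} → E x x → IsClass E (E x)
  classOf {x} exx = x , exx , λ _ → (λ e → e) , (λ e → e)

  -- Sandwiching a subrelation of E between copies of E stays inside E,
  -- so only the covering half of E|p|E = E is ever in question.
  sandwich-⊆ : ∀ {p} → p ⊆ E → (E ∣ p ∣ E) ⊆ E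
  sandwich-⊆ p⊆E x z (y , exy , w , pyw , ewz) = E-trans exy (E-trans (p⊆E y w pyw) ewz)

  shrink : ∀ {p q R} → p ⊆ E → q ⊆ E → (E ∣ p ∣ R ∣ q ∣ E) ⊆ (E ∣ R ∣ E)
  shrink p⊆E q⊆E x z (a , exa , a' , paa' , b , rab , b' , qbb' , eb'z) =
    a' , E-trans exa (p⊆E a a' paa') , b , rab , E-trans (q⊆E b b' qbb') eb'z

  drop-identity : ∀ {p R S} → p ⊆ Id E → (E ∣ R ∣ p ∣ S ∣ E) ⊆ (E ∣ R ∣ S ∣ E)
  drop-identity p⊆Id x z (a , exa , b , rab , b' , pbb' , c , sb'c , ecz)
    with proj₁ (p⊆Id b b' pbb')
  ... | refl = a , exa , b , rab , c , sb'c , ecz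

  Pt-intro : ∀ {p} → p ⊆ E → E ⊆ (E ∣ p ∣ E) →
             (∀ {a b c d} → p a b → E b c → p c d → a ≡ d) → Pt E p
  Pt-intro p⊆E cover unique =
    p⊆E , (sandwich-⊆ p⊆E , cover) ,
    λ { a d (b , pab , c , ebc , pcd) → unique pab ebc pcd , E-reflˡ (p⊆E a b pab) }

  module PointFacts {p : Rel₂ A} (pt : Pt E p) where

    p⊆E : ∀ {x y} → p x y → E x y
    p⊆E {x} {y} = proj₁ pt x y

    cover : ∀ {x y} → E x y → (E ∣ p ∣ E) x y
    cover {x} {y} = proj₂ (proj₁ (proj₂ pt)) x y

    unique : ∀ {a b c d} → p a b → E b c → p c d → a ≡ d
    unique {a} {b} {c} {d} pab ebc pcd = proj₁ (proj₂ (proj₂ pt) a d (b , pab , c , ebc , pcd))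

    diag : ∀ {a b} → p a b → a ≡ b
    diag pab = unique pab (E-sym (p⊆E pab)) pab

    loopˡ : ∀ {a b} → p a b → p a a
    loopˡ {a} pab = subst (p a) (sym (diag pab)) pab

    loopʳ : ∀ {a b} → p a b → p b b
    loopʳ {b = b} pab = subst (λ t → p t b) (diag pab) pab

    point-unique : ∀ {a b c d} → p a b → p c d → E a c → a ≡ c
    point-unique pab pcd eac =
      trans (unique pab (E-trans (E-sym (p⊆E pab)) eac) pcd) (sym (diag pcd))

  Fix : (A → A) → Rel₂ A
  Fix f x y = (x ≡ y) × E x x × (f x ≡ x)

  module FixedPoints (f : A → A)
                     (in-class : ∀ {x} → E x x → E x (f x))
                     (invariant : ∀ {x y} → E x y → f x ≡ f y) where

    Fix-at : ∀ {x} → E x x → Fix f (f x) (f x)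
    Fix-at exx = refl , E-reflʳ (in-class exx) , sym (invariant (in-class exx))

    Fix-point : Pt E (Fix f)
    Fix-point = Pt-intro Fix⊆E cover unique
      where
      Fix⊆E : Fix f ⊆ E
      Fix⊆E x .x (refl , exx , _) = exx
      cover : E ⊆ (E ∣ Fix f ∣ E)
      cover x z exz = f x , exm , f x , Fix-at (E-reflˡ exz) , E-trans (E-sym exm) exz
        where exm = in-class (E-reflˡ exz)
      unique : ∀ {a b c d} → Fix f a b → E b c → Fix f c d → a ≡ d
      unique (refl , _ , fa≡a) ebc (refl , _ , fc≡c) = trans (sym fa≡a) (trans (invariant ebc) fc≡c)

  SinglesOut : Rel₂ A → (A → Set) → A → Set
  SinglesOut p U u = ∀ x y → ((p x y × U x × U y) → (x ≡ u × y ≡ u)) × ((x ≡ u × y ≡ u) → (p x y × U x × U y))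

  -- (i), forward: a point singles out an element in every class, namely the
  -- loop through which the class representative is covered.
  point⇒singles : ∀ {p} → Pt E p → ∀ U → IsClass E U → ∃[ u ] (U u × SinglesOut p U u)
  point⇒singles {p} pt U (a , eaa , U≐Ea) = singled (cover eaa)
    where
    open PointFacts pt
    toRep : ∀ {x} → U x → E x a
    toRep Ux = E-sym (proj₁ (U≐Ea _) Ux)
    singled : (E ∣ p ∣ E) a a → ∃[ u ] (U u × SinglesOut p U u)
    singled (u , eau , u' , puu' , _) = u , Uu , λ x y →
        (λ { (pxy , Ux , Uy) → point-unique pxy puu (E-trans (toRep Ux) eau)
                             , point-unique (loopʳ pxy) puu (E-trans (toRep Uy) eau) })
      , (λ { (refl , refl) → puu , Uu , Uu })
      where
      puu = loopˡ puu'
      Uu = proj₂ (U≐Ea u) eau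

  singles⇒point : ∀ {p} → p ⊆ E → (∀ U → IsClass E U → ∃[ u ] (U u × SinglesOut p U u)) → Pt E p
  singles⇒point {p} p⊆E singles = Pt-intro p⊆E cover unique
    where
    centre : ∀ {a} → E a a → A
    centre eaa = proj₁ (singles _ (classOf eaa))
    centre-in-class : ∀ {a} (eaa : E a a) → E a (centre eaa)
    centre-in-class eaa = proj₁ (proj₂ (singles _ (classOf eaa)))
    centre-loop : ∀ {a} (eaa : E a a) → p (centre eaa) (centre eaa)
    centre-loop eaa = proj₁ (proj₂ (proj₂ (proj₂ (singles _ (classOf eaa))) _ _) (refl , refl))
    at-centre : ∀ {a x y} (eaa : E a a) → p x y → E a x → E a y → (x ≡ centre eaa) × (y ≡ centre eaa)
    at-centre eaa pxy eax eay = proj₁ (proj₂ (proj₂ (singles _ (classOf eaa))) _ _) (pxy , eax , eay)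

    cover : E ⊆ (E ∣ p ∣ E)
    cover x z exz = centre exx , centre-in-class exx , centre exx , centre-loop exx ,
                    E-trans (E-sym (centre-in-class exx)) exz
      where exx = E-reflˡ exz
    unique : ∀ {a b c d} → p a b → E b c → p c d → a ≡ d
    unique {a} {b} {c} {d} pab ebc pcd =
      trans (proj₁ (at-centre eaa pab eaa eab)) (sym (proj₂ (at-centre eaa pcd eac (E-trans eac (p⊆E c d pcd)))))
      where
      eab = p⊆E a b pab
      eaa = E-reflˡ eab
      eac = E-trans eab ebc

  point-symmetric : ∀ {p} → Pt E p → p ⊆ inv p
  point-symmetric {p} pt x y pxy = subst (p y) (sym (diag pxy)) (loopʳ pxy)
    where open PointFacts pt

  point⊆Id : ∀ {p} → Pt E p → p ⊆ Id E
  point⊆Id pt x y pxy = diag pxy , E-reflˡ (p⊆E pxy)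
    where open PointFacts pt

  -- (iii)(a): between two points, E|p|-|q|E preserves intersections, since
  -- both witnesses must pass through the same loops of p and of q.
  conjugate-∩ : ∀ {p q R S} → Pt E p → Pt E q →
                ((E ∣ p ∣ R ∣ q ∣ E) ∩ (E ∣ p ∣ S ∣ q ∣ E)) ⊆ (E ∣ p ∣ (R ∩ S) ∣ q ∣ E)
  conjugate-∩ {S = S} ptp ptq x z
    ((a , exa , a' , paa' , b , rab , b' , qbb' , eb'z) , (c , exc , c' , pcc' , d , scd , d' , qdd' , ed'z)) =
    a , exa , a' , paa' , b , (rab , subst₂ S c'≡a' d≡b scd) , b' , qbb' , eb'z
    where
    module P = PointFacts ptp
    module Q = PointFacts ptq
    c'≡a' : c' ≡ a'
    c'≡a' = P.point-unique (P.loopʳ pcc') (P.loopʳ paa')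
              (E-trans (E-sym (P.p⊆E pcc')) (E-trans (E-sym exc) (E-trans exa (P.p⊆E paa'))))
    d≡b : d ≡ b
    d≡b = Q.point-unique qdd' qbb' (E-trans (Q.p⊆E qdd') (E-trans ed'z (E-trans (E-sym eb'z) (E-sym (Q.p⊆E qbb')))))

  conjugate-∩⁻ : ∀ {p q R S} → (E ∣ p ∣ (R ∩ S) ∣ q ∣ E) ⊆ ((E ∣ p ∣ R ∣ q ∣ E) ∩ (E ∣ p ∣ S ∣ q ∣ E))
  conjugate-∩⁻ x z (a , exa , a' , paa' , b , (rab , sab) , b' , qbb' , eb'z) =
    (a , exa , a' , paa' , b , rab , b' , qbb' , eb'z) , (a , exa , a' , paa' , b , sab , b' , qbb' , eb'z)

  -- (iii)(b): passing through a point from the right and from the left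
  -- means passing through the same loop.
  through-point : ∀ {p R S} → R ⊆ E → Pt E p →
                  ((E ∣ R ∣ p ∣ E) ∩ (E ∣ p ∣ S ∣ E)) ⊆ (E ∣ R ∣ p ∣ S ∣ E)
  through-point {S = S} R⊆E ptp x z ((a , exa , b , rab , b' , pbb' , eb'z) , (c , exc , c' , pcc' , d , sc'd , edz)) =
    a , exa , b , rab , b' , pbb' , d , subst (λ t → S t d) c'≡b' sc'd , edz
    where
    open PointFacts ptp
    c'≡b' : c' ≡ b'
    c'≡b' = point-unique (loopʳ pcc') (loopʳ pbb')
              (E-trans (E-sym (p⊆E pcc')) (E-trans (E-sym exc) (E-trans exa (E-trans (R⊆E a b rab) (p⊆E pbb')))))

  through-point⁻ : ∀ {p R S} → R ⊆ E → S ⊆ E → Pt E p →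
                   (E ∣ R ∣ p ∣ S ∣ E) ⊆ ((E ∣ R ∣ p ∣ E) ∩ (E ∣ p ∣ S ∣ E))
  through-point⁻ R⊆E S⊆E ptp x z (a , exa , b , rab , b' , pbb' , d , sb'd , edz) =
    (a , exa , b , rab , b' , pbb' , E-trans (S⊆E b' d sb'd) edz) ,
    (b , E-trans exa (R⊆E a b rab) , b' , pbb' , d , sb'd , edz)

  -- (iii)(c): a relation between two loops can be read backwards.
  conjugate-inv : ∀ {p q R} → R ⊆ E → Pt E p → Pt E q → (E ∣ p ∣ R ∣ q ∣ E) ⊆ (E ∣ q ∣ inv R ∣ p ∣ E)
  conjugate-inv R⊆E ptp ptq x z (a , exa , a' , paa' , b , ra'b , b' , qbb' , eb'z) =
    b , E-trans exa (E-trans (P.p⊆E paa') ea'b) , b , Q.loopˡ qbb' , a' , ra'b , a' , P.loopʳ paa' ,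
    E-trans ea'b (E-trans (Q.p⊆E qbb') eb'z)
    where
    module P = PointFacts ptp
    module Q = PointFacts ptq
    ea'b = R⊆E _ _ ra'b

  inv-⊆E : ∀ {R} → R ⊆ E → inv R ⊆ E
  inv-⊆E R⊆E x y r = E-sym (R⊆E y x r)

  module Selection (lem : LEM) (ch : ExtChoice A) where

    record Selector (Good : A → Set) : Set where
      field
        sel : A → A
        in-class : ∀ {x} → E x x → E x (sel x)
        invariant : ∀ {x y} → E x y → sel x ≡ sel y
        picks-good : ∀ {x a} → E x a → Good a → Good (sel x)

      open FixedPoints sel in-class invariant public

    selector : (Good : A → Set) → Selector Good
    selector Good = record { sel = sel ; in-class = in-class ; invariant = invariant ; picks-good = picks-good }
      where
      ε = proj₁ ch
      Admissible : A → A → Set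
      Admissible x a = E x a × (∃[ b ] (E x b × Good b) → Good a)
      sel : A → A
      sel x = ε (Admissible x)
      admissible-invariant : ∀ {x y a} → E x y → Admissible x a → Admissible y a
      admissible-invariant exy (exa , good) =
        E-trans (E-sym exy) exa , λ { (b , eyb , gb) → good (b , E-trans exy eyb , gb) }
      admissible-exists : ∀ {x} → E x x → ∃[ a ] Admissible x a
      admissible-exists {x} exx with lem (∃[ b ] (E x b × Good b))
      ... | inj₁ (b , exb , gb) = b , exb , λ _ → gb
      ... | inj₂ none = x , exx , λ some → ⊥-elim (none some)
      sel-admissible : ∀ {x} → E x x → Admissible x (sel x)
      sel-admissible exx = proj₁ (proj₂ ch) _ (admissible-exists exx)
      in-class : ∀ {x} → E x x → E x (sel x)
      in-class exx = proj₁ (sel-admissible exx)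
      invariant : ∀ {x y} → E x y → sel x ≡ sel y
      invariant exy = proj₂ (proj₂ ch) _ _
        (λ a → admissible-invariant exy , admissible-invariant (E-sym exy))
      picks-good : ∀ {x a} → E x a → Good a → Good (sel x)
      picks-good exa ga = proj₂ (sel-admissible (E-reflˡ exa)) (_ , exa , ga)

    -- (iv): choose an R-source in each class, then an R-target of it.
    conjugate-by-points : ∀ R → R ⊆ E → ∃[ p ] ∃[ q ] (Pt E p × Pt E q × ((E ∣ R ∣ E) ≐ (E ∣ p ∣ R ∣ q ∣ E)))
    conjugate-by-points R R⊆E =
      Fix S.sel , Fix T.sel , S.Fix-point , T.Fix-point , spread , shrink (proj₁ S.Fix-point) (proj₁ T.Fix-point)
      where
      module S = Selector (selector (λ a → ∃[ b ] R a b))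
      module T = Selector (selector (λ b → R (S.sel b) b))
      spread : (E ∣ R ∣ E) ⊆ (E ∣ Fix S.sel ∣ R ∣ Fix T.sel ∣ E)
      spread x z (a , exa , b , rab , ebz) = via (S.picks-good exa (b , rab))
        where
        exx = E-reflˡ exa
        exz = E-trans exa (E-trans (R⊆E a b rab) ebz)
        -- the selected target of the selected source is still an R-target of it
        via : ∃[ c ] R (S.sel x) c → (E ∣ Fix S.sel ∣ R ∣ Fix T.sel ∣ E) x z
        via (c , rsc) =
          S.sel x , S.in-class exx , S.sel x , S.Fix-at exx , T.sel x , rst , T.sel x , T.Fix-at exx ,
          E-trans (E-sym (T.in-class exx)) exz
          where
          exc = E-trans (S.in-class exx) (R⊆E _ c rsc)
          rst : R (S.sel x) (T.sel x)
          rst = subst (λ t → R t (T.sel x)) (S.invariant (E-sym (T.in-class exx)))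
                  (T.picks-good exc (subst (λ t → R t c) (S.invariant exc) rsc))

    -- (v): choose in each class an element that is both an R-target and an S-source.
    factor-through-point : ∀ R S → R ⊆ E → S ⊆ E → ∃[ p ] (Pt E p × ((E ∣ R ∣ S ∣ E) ≐ (E ∣ R ∣ p ∣ S ∣ E)))
    factor-through-point R S R⊆E S⊆E =
      Fix M.sel , M.Fix-point , factor , drop-identity (point⊆Id M.Fix-point)
      where
      module M = Selector (selector (λ m → (∃[ a ] R a m) × (∃[ c ] S m c)))
      factor : (E ∣ R ∣ S ∣ E) ⊆ (E ∣ R ∣ Fix M.sel ∣ S ∣ E)
      factor x z (a , exa , b , rab , c , sbc , ecz) = via (M.picks-good exb ((a , rab) , (c , sbc)))
        where
        exb = E-trans exa (R⊆E a b rab)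
        exz = E-trans exb (E-trans (S⊆E b c sbc) ecz)
        exm = M.in-class (E-reflˡ exa)
        via : (∃[ a' ] R a' (M.sel x)) × (∃[ c' ] S (M.sel x) c') → (E ∣ R ∣ Fix M.sel ∣ S ∣ E) x z
        via ((a' , ra'm) , (c' , smc')) =
          a' , E-trans exm (E-sym (R⊆E _ _ ra'm)) , M.sel x , ra'm , M.sel x , M.Fix-at (E-reflˡ exa) ,
          c' , smc' , E-trans (E-sym (S⊆E _ _ smc')) (E-trans (E-sym exm) exz)

lemma3p2p6 : {A : Set} → LEM → ExtChoice A → (E : Rel₂ A) → IsEquivRel E → NonEmpty E →
    -- (i)
    (∀ (p : Rel₂ A) → p ⊆ E →
        (Pt E p → ∀ (U : A → Set) → IsClass E U →
            ∃[ u ] (U u × (∀ x y → ((p x y × U x × U y) → (x ≡ u × y ≡ u)) × ((x ≡ u × y ≡ u) → (p x y × U x × U y)))))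
      × ((∀ (U : A → Set) → IsClass E U →
            ∃[ u ] (U u × (∀ x y → ((p x y × U x × U y) → (x ≡ u × y ≡ u)) × ((x ≡ u × y ≡ u) → (p x y × U x × U y))))) → Pt E p))
    -- (ii)
  × (∀ (p : Rel₂ A) → Pt E p → (p ≐ inv p) × (p ⊆ Id E))
    -- (iii)
  × (∀ (R S p q : Rel₂ A) → R ⊆ E → S ⊆ E → Pt E p → Pt E q →
        (((E ∣ p ∣ R ∣ q ∣ E) ∩ (E ∣ p ∣ S ∣ q ∣ E)) ≐ (E ∣ p ∣ (R ∩ S) ∣ q ∣ E))
      × (((E ∣ R ∣ p ∣ E) ∩ (E ∣ p ∣ S ∣ E)) ≐ (E ∣ R ∣ p ∣ S ∣ E))
      × ((E ∣ p ∣ R ∣ q ∣ E) ≐ (E ∣ q ∣ inv R ∣ p ∣ E)))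
    -- (iv)
  × (∀ (R : Rel₂ A) → R ⊆ E → ∃[ p ] ∃[ q ] (Pt E p × Pt E q × ((E ∣ R ∣ E) ≐ (E ∣ p ∣ R ∣ q ∣ E))))
    -- (v)
  × (∀ (R S : Rel₂ A) → R ⊆ E → S ⊆ E → ∃[ p ] (Pt E p × ((E ∣ R ∣ S ∣ E) ≐ (E ∣ R ∣ p ∣ S ∣ E))))
lemma3p2p6 lem ch E isE _ =
    (λ p p⊆E → point⇒singles , singles⇒point p⊆E)
  , (λ p pt → (point-symmetric pt , λ x y → point-symmetric pt y x) , point⊆Id pt)
  , (λ R S p q R⊆E S⊆E ptp ptq →
        (conjugate-∩ ptp ptq , conjugate-∩⁻)
      , (through-point R⊆E ptp , through-point⁻ R⊆E S⊆E ptp)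
      , (conjugate-inv R⊆E ptp ptq , conjugate-inv (inv-⊆E R⊆E) ptq ptp))
  , conjugate-by-points
  , factor-through-point
  where
  open Points E isE
  open Selection lem ch
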